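{- Let $c$ be a positive integer and let $N,a,b\in\mathbb{Z}$ with $(a,b)\neq(0,0)$. Then $N$ is a multiple in the ring $\mathbb{Z}[\sqrt{ -c}]$ of $a+b\sqrt{ -c}$ if and only if $N$ is a multiple in $\mathbb{Z}$ of the integer $\frac{a^2+cb^2}{\gcd(a,b)}$.
   Context: Here $\sqrt{ -c}=i\sqrt{c}\in\mathbb{C}$ and $\mathbb{Z}[\sqrt{ -c}]=\{x+y\sqrt{ -c}: x,y\in\mathbb{Z}\}$. -}

module Defs where

open import Data.Nat as ℕ using (ℕ)
import Data.Nat.GCD as ℕG
open import Data.Integer
open import Data.Integer.GCD using (gcd)
open import Data.Integer.Properties using (∣i∣≡0⇒i≡0)
open import Data.Product using (_×_; _,_; ∃₂)
open import Relation.Binary.PropositionalEquality using (_≡_; refl)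
open import Relation.Nullary using (¬_)

record ℤ√- (c : ℕ) : Set where
  constructor _+_√-
  field
    re : ℤ
    im : ℤ

embed : {c : ℕ} → ℤ → ℤ√- c
embed N = N + 0ℤ √-

mul : {c : ℕ} → ℤ√- c → ℤ√- c → ℤ√- c
mul {c} (x₁ + y₁ √-) (x₂ + y₂ √-) =
  (x₁ * x₂ - (+ c) * (y₁ * y₂)) + (x₁ * y₂ + y₁ * x₂) √-

_∣√_ : {c : ℕ} → ℤ√- c → ℤ√- c → Set
_∣√_ {c} β α = ∃₂ λ (x y : ℤ) → α ≡ mul β (x + y √-)

gcd-nonZero : ∀ a b → ¬ (a ≡ 0ℤ × b ≡ 0ℤ) → NonZero (gcd a b)
gcd-nonZero a b h with ℕG.gcd ∣ a ∣ ∣ b ∣ in eq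
... | ℕ.suc _ = _
... | ℕ.zero with ℕG.gcd[m,n]≡0⇒m≡0 eq | ℕG.gcd[m,n]≡0⇒n≡0 ∣ a ∣ eq
...   | p | q with h (∣i∣≡0⇒i≡0 p , ∣i∣≡0⇒i≡0 q)
...     | ()

normOverGcd : (c : ℕ) (a b : ℤ) → ¬ (a ≡ 0ℤ × b ≡ 0ℤ) → ℤ
normOverGcd c a b h =
  _/_ (a * a + (+ c) * (b * b)) (gcd a b) {{gcd-nonZero a b h}}

{-# OPTIONS --safe #-}
-- Write g = gcd(a,b), a = g a′ and b = g b′, so that (a² + c b²)/g = g (a′² + c b′²).
-- If N = (a + b√-c)(x + y√-c), the imaginary part gives a y + b x = 0; with a Bézout
-- combination g = u a + v b this forces (x , y) = t (a′ , -b′) for t = u x - v y, and then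
-- N = t g (a′² + c b′²). Conversely q g (a′² + c b′²) = (a + b√-c) · q (a′ - b′√-c).
module Submission where

open import Defs
open import Data.Nat using (ℕ; NonZero)
open import Data.Integer using (ℤ; 0ℤ)
open import Data.Integer.Divisibility using (_∣_)
open import Data.Product using (_×_)
open import Relation.Binary.PropositionalEquality using (_≡_)
open import Relation.Nullary using (¬_)
open import Function.Bundles using (_⇔_)

import Data.Nat as ℕ
import Data.Nat.DivMod as ℕ
import Data.Nat.Divisibility as ℕ
import Data.Nat.GCD as ℕ
open import Data.Integer hiding (NonZero)
import Data.Integer as ℤ using (NonZero)
open import Data.Integer.Properties
open import Data.Integer.DivMod using (a≡a%n+[a/n]*n; n%d<d)
open import Data.Integer.GCD using (gcd; gcd[i,j]∣i; gcd[i,j]∣j)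
open import Data.Integer.Divisibility.Signed using (divides; ∣ᵤ⇒∣; ∣⇒∣ᵤ)
open import Data.Integer.Tactic.RingSolver using (solve; solve-∀)
open import Data.List using (_∷_; [])
open import Data.Product using (_,_; ∃₂)
open import Function.Bundles using (mk⇔)
open import Relation.Binary.PropositionalEquality
  using (sym; trans; cong; cong₂; subst₂; module ≡-Reasoning)

i*j≡n+q*j⇒n≡[i-q]*j : ∀ i j n q → i * j ≡ n + q * j → n ≡ (i - q) * j
i*j≡n+q*j⇒n≡[i-q]*j i j n q eq = begin
  n                   ≡⟨ solve (n ∷ q ∷ j ∷ []) ⟩
  (n + q * j) - q * j ≡⟨ cong (_- q * j) (sym eq) ⟩
  i * j - q * j       ≡⟨ solve (i ∷ q ∷ j ∷ []) ⟩
  (i - q) * j         ∎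
  where open ≡-Reasoning

[i*j]/j≡i : ∀ i j .{{_ : ℤ.NonZero j}} → (i * j) / j ≡ i
[i*j]/j≡i i j = sym (*-cancelʳ-≡ i q j (begin
  i * j          ≡⟨ division ⟩
  + r + q * j    ≡⟨ cong (λ n → + n + q * j) r≡0 ⟩
  0ℤ + q * j     ≡⟨ +-identityˡ (q * j) ⟩
  q * j          ∎))
  where
  open ≡-Reasoning
  q = (i * j) / j
  r = (i * j) % j
  division : i * j ≡ + r + q * j
  division = a≡a%n+[a/n]*n (i * j) j
  r≡0 : r ≡ 0
  r≡0 = trans (sym (ℕ.m<n⇒m%n≡m (n%d<d (i * j) j)))
              (ℕ.n∣m⇒m%n≡0 r ∣ j ∣ (∣⇒∣ᵤ (divides (i - q) (i*j≡n+q*j⇒n≡[i-q]*j i j (+ r) q division))))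

d+y*n≡x*m⇒x*m-y*n≡d : ∀ d x y m n → d + y * n ≡ x * m → x * m + - y * n ≡ d
d+y*n≡x*m⇒x*m-y*n≡d d x y m n eq = begin
  x * m + - y * n       ≡⟨ cong (_+ - y * n) (sym eq) ⟩
  (d + y * n) + - y * n ≡⟨ solve (d ∷ y ∷ n ∷ []) ⟩
  d                     ∎
  where open ≡-Reasoning

ℕ-Bézout⇒ℤ-combination : ∀ {d m n} → ℕ.Bézout.Identity d m n →
                         ∃₂ λ u v → u * + m + v * + n ≡ + d
ℕ-Bézout⇒ℤ-combination {d} {m} {n} (ℕ.Bézout.+- x y eq) =
  + x , - + y , d+y*n≡x*m⇒x*m-y*n≡d (+ d) (+ x) (+ y) (+ m) (+ n) (begin
    + d + + y * + n          ≡⟨ cong (_+_ (+ d)) (sym (pos-* y n)) ⟩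
    + d + + (y ℕ.* n)        ≡⟨ sym (pos-+ d (y ℕ.* n)) ⟩
    + (d ℕ.+ y ℕ.* n)        ≡⟨ cong +_ eq ⟩
    + (x ℕ.* m)              ≡⟨ pos-* x m ⟩
    + x * + m                ∎)
  where open ≡-Reasoning
ℕ-Bézout⇒ℤ-combination {m = m} {n} (ℕ.Bézout.-+ x y eq)
  with ℕ-Bézout⇒ℤ-combination (ℕ.Bézout.+- y x eq)
... | v , u , eq′ = u , v , trans (+-comm (u * + m) (v * + n)) eq′

+∣i∣≡sign[i]◃1*i : ∀ i → + ∣ i ∣ ≡ (sign i ◃ 1) * i
+∣i∣≡sign[i]◃1*i (+ n)    = sym (*-identityˡ (+ n))
+∣i∣≡sign[i]◃1*i -[1+ n ] = sym (-1*i≡-i -[1+ n ])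

gcd-Bézout : ∀ i j → ∃₂ λ u v → u * i + v * j ≡ gcd i j
gcd-Bézout i j with ℕ-Bézout⇒ℤ-combination (ℕ.Bézout.identity (ℕ.gcd-GCD ∣ i ∣ ∣ j ∣))
... | u , v , eq = u * (sign i ◃ 1) , v * (sign j ◃ 1) , (begin
  u * (sign i ◃ 1) * i + v * (sign j ◃ 1) * j
    ≡⟨ cong₂ _+_ (*-assoc u _ i) (*-assoc v _ j) ⟩
  u * ((sign i ◃ 1) * i) + v * ((sign j ◃ 1) * j)
    ≡⟨ cong₂ (λ p q → u * p + v * q) (sym (+∣i∣≡sign[i]◃1*i i)) (sym (+∣i∣≡sign[i]◃1*i j)) ⟩
  u * + ∣ i ∣ + v * + ∣ j ∣
    ≡⟨ eq ⟩
  gcd i j ∎)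
  where open ≡-Reasoning

a*y+b*x≡0⇒[x,y]≡t[a′,-b′] : ∀ a′ b′ g u v x y .{{_ : ℤ.NonZero g}} →
  u * (a′ * g) + v * (b′ * g) ≡ g → (a′ * g) * y + (b′ * g) * x ≡ 0ℤ →
  x ≡ a′ * (u * x - v * y) × y ≡ - b′ * (u * x - v * y)
a*y+b*x≡0⇒[x,y]≡t[a′,-b′] a′ b′ g u v x y bézout orthogonal =
  *-cancelʳ-≡ x (a′ * t) g (begin
    x * g                                   ≡⟨ cong (x *_) (sym bézout) ⟩
    x * (u * (a′ * g) + v * (b′ * g))       ≡⟨ x-expansion a′ b′ g u v x y ⟩
    a′ * t * g + v * ((a′ * g) * y + (b′ * g) * x) ≡⟨ cong (λ z → a′ * t * g + v * z) orthogonal ⟩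
    a′ * t * g + v * 0ℤ                     ≡⟨ i+j*0≡i (a′ * t * g) v ⟩
    a′ * t * g                              ∎) ,
  *-cancelʳ-≡ y (- b′ * t) g (begin
    y * g                                   ≡⟨ cong (y *_) (sym bézout) ⟩
    y * (u * (a′ * g) + v * (b′ * g))       ≡⟨ y-expansion a′ b′ g u v x y ⟩
    - b′ * t * g + u * ((a′ * g) * y + (b′ * g) * x) ≡⟨ cong (λ z → - b′ * t * g + u * z) orthogonal ⟩
    - b′ * t * g + u * 0ℤ                   ≡⟨ i+j*0≡i (- b′ * t * g) u ⟩
    - b′ * t * g                            ∎)
  where
  open ≡-Reasoning
  t = u * x - v * y
  i+j*0≡i : ∀ i j → i + j * 0ℤ ≡ i
  i+j*0≡i = solve-∀
  x-expansion : ∀ a′ b′ g u v x y → x * (u * (a′ * g) + v * (b′ * g)) ≡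
    a′ * (u * x - v * y) * g + v * ((a′ * g) * y + (b′ * g) * x)
  x-expansion = solve-∀
  y-expansion : ∀ a′ b′ g u v x y → y * (u * (a′ * g) + v * (b′ * g)) ≡
    - b′ * (u * x - v * y) * g + u * ((a′ * g) * y + (b′ * g) * x)
  y-expansion = solve-∀

module _ {c : ℕ} where

  conj : ℤ√- c → ℤ√- c
  conj (x + y √-) = x + (- y) √-

  norm : ℤ√- c → ℤ
  norm (x + y √-) = x * x + + c * (y * y)

  scale : ℤ → ℤ√- c → ℤ√- c
  scale s (x + y √-) = (x * s) + (y * s) √-

  norm-scale : ∀ g α → norm (scale g α) ≡ (g * norm α) * g
  norm-scale g (x + y √-) = identity x y g (+ c)
    where
    identity : ∀ x y g C → (x * g) * (x * g) + C * ((y * g) * (y * g)) ≡ (g * (x * x + C * (y * y))) * g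
    identity = solve-∀

  mul-scale-conj : ∀ g q α → mul (scale g α) (scale q (conj α)) ≡ embed (q * (g * norm α))
  mul-scale-conj g q (x + y √-) = cong₂ _+_√- (re-identity x y g q (+ c)) (im-identity x y g q)
    where
    re-identity : ∀ x y g q C →
      (x * g) * (x * q) - C * ((y * g) * (- y * q)) ≡ q * (g * (x * x + C * (y * y)))
    re-identity = solve-∀
    im-identity : ∀ x y g q → (x * g) * (- y * q) + (y * g) * (x * q) ≡ 0ℤ
    im-identity = solve-∀

scale-∣√-embed⇔ : ∀ {c} g a′ b′ u v .{{_ : ℤ.NonZero g}} → u * (a′ * g) + v * (b′ * g) ≡ g →
  ∀ N → _∣√_ {c} (scale g (a′ + b′ √-)) (embed N) ⇔ (g * norm {c} (a′ + b′ √-)) ∣ N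
scale-∣√-embed⇔ {c} g a′ b′ u v bézout N = mk⇔ to from
  where
  open ≡-Reasoning
  α : ℤ√- c
  α = a′ + b′ √-
  to : scale g α ∣√ embed N → (g * norm α) ∣ N
  to (x , y , N≡) with a*y+b*x≡0⇒[x,y]≡t[a′,-b′] a′ b′ g u v x y bézout (sym (cong ℤ√-.im N≡))
  ... | x≡ , y≡ = ∣⇒∣ᵤ (divides (u * x - v * y) (cong ℤ√-.re (begin
    embed N                                  ≡⟨ N≡ ⟩
    mul (scale g α) (x + y √-)               ≡⟨ cong₂ (λ p q → mul (scale g α) (p + q √-)) x≡ y≡ ⟩
    mul (scale g α) (scale (u * x - v * y) (conj α)) ≡⟨ mul-scale-conj g (u * x - v * y) α ⟩
    embed ((u * x - v * y) * (g * norm α))  ∎)))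
  from : (g * norm α) ∣ N → scale g α ∣√ embed N
  from g*norm∣N with ∣ᵤ⇒∣ g*norm∣N
  ... | divides q N≡ = a′ * q , - b′ * q , trans (cong embed N≡) (sym (mul-scale-conj g q α))

proposition1 : (c : ℕ) → .{{_ : NonZero c}} → (N a b : ℤ) → (h : ¬ (a ≡ 0ℤ × b ≡ 0ℤ)) →
    (_∣√_ {c} (a + b √-) (embed N)) ⇔ (normOverGcd c a b h ∣ N)
proposition1 c N a b h
  with ∣ᵤ⇒∣ (gcd[i,j]∣i a b) | ∣ᵤ⇒∣ (gcd[i,j]∣j a b) | gcd-Bézout a b
... | divides a′ a≡ | divides b′ b≡ | u , v , bézout =
  subst₂ (λ β K → _∣√_ {c} β (embed N) ⇔ K ∣ N)
    (sym β≡) (sym normOverGcd≡)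
    (scale-∣√-embed⇔ g a′ b′ u v (subst₂ (λ p q → u * p + v * q ≡ g) a≡ b≡ bézout) N)
  where
  open ≡-Reasoning
  g = gcd a b
  instance
    g≢0 : ℤ.NonZero g
    g≢0 = gcd-nonZero a b h
  α : ℤ√- c
  α = a′ + b′ √-
  β≡ : a + b √- ≡ scale g α
  β≡ = cong₂ _+_√- a≡ b≡
  normOverGcd≡ : normOverGcd c a b h ≡ g * norm α
  normOverGcd≡ = begin
    norm {c} (a + b √-) / g   ≡⟨ cong (λ β → norm β / g) β≡ ⟩
    norm (scale g α) / g      ≡⟨ cong (_/ g) (norm-scale g α) ⟩
    (g * norm α) * g / g      ≡⟨ [i*j]/j≡i (g * norm α) g ⟩
    g * norm α                ∎
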